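{- Let $A_0, A_1, A_2, A_3, B_3, A_4, B_4, \ldots$ be pairwise distinct letters and let the words $v_n, u_n, w_n$ be defined as in the context. Then for every $n\geq 7$, $$|v_n|\geq 3|v_{n-2}|+2|w_{n-6}|+2|v_{n-4}|+6.$$
   Context: For a word $x$, $|x|$ is its length, $\widetilde{x}$ denotes its reversal and $\epsilon$ the empty word. If $X$ is a prefix of $Y$, then $X^{ -1}Y$ denotes $Y$ with the prefix $X$ deleted; if $Z$ is a suffix of $Y$, then $YZ^{ -1}$ denotes $Y$ with the suffix $Z$ deleted. Construction. Put $w_1=A_1$, $w_2=A_0A_2A_0$, $v_3=u_3=\epsilon$, $v_4=u_4=A_0$, $v_5=A_5A_3A_1A_3$, $u_5=B_3A_1A_3A_1$, $v_6=A_0A_6A_0A_4A_0A_2A_0A_4A_0$, $u_6=A_0B_4A_0A_2A_0A_4A_0A_2A_0$, and for $3\leq n\leq 6$ let $w_n=v_nA_nw_{n-2}B_nw_{n-2}A_nw_{n-2}B_nu_n$. For $n\geq 7$: let $P_n$ be the longest common prefix of $w_{n-6}$ and $\widetilde{v_{n-4}}$, let $c_n$ be the first letter of $P_n^{ -1}\widetilde{v_{n-4}}A_{n-2}$, let $d_n$ be the first letter of $P_n^{ -1}w_{n-6}B_{n-4}$, and define $v_n=(P_nc_n)^{ -1}\widetilde{v_{n-4}}A_{n-2}\widetilde{v_{n-2}}A_nv_{n-2}A_{n-2}v_{n-4}A_{n-4}w_{n-6}B_{n-4}\widetilde{w_{n-6}}A_{n-4}\widetilde{v_{n-4}}A_{n-2}\widetilde{v_{n-2}}$,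 $u_n=\widetilde{u_{n-2}}B_{n-2}\widetilde{w_{n-4}}A_{n-2}w_{n-4}B_{n-2}\widetilde{u_{n-4}}B_{n-4}\widetilde{w_{n-6}}(d_n\widetilde{P_n})^{ -1}$, $w_n=v_nA_nw_{n-2}B_n\widetilde{w_{n-2}}A_nw_{n-2}B_nu_n$. -}

module Defs where

open import Data.Bool using (Bool; true; false; if_then_else_)
open import Data.Nat using (ℕ; zero; suc; _+_; _∸_; _≡ᵇ_)
open import Data.List using (List; []; _∷_; _++_; [_]; reverse; length; drop; take)
open import Data.Product using (_×_; _,_; proj₁; proj₂)

-- The alphabet: letters A_i (i ∈ ℕ) and B_i; distinct constructors/indices
-- give pairwise distinct letters (B_0, B_1, B_2 exist but are never used).
data Letter : Set where
  A : ℕ → Letter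
  B : ℕ → Letter

Word : Set
Word = List Letter

eqL : Letter → Letter → Bool
eqL (A m) (A n) = m ≡ᵇ n
eqL (B m) (B n) = m ≡ᵇ n
eqL _ _ = false

lcp : Word → Word → Word
lcp (x ∷ xs) (y ∷ ys) = if eqL x y then x ∷ lcp xs ys else []
lcp _ _ = []

-- first letter (default only used on empty words, which never occurs here)
firstLetter : Word → Letter
firstLetter (x ∷ _) = x
firstLetter [] = A 0

-- X⁻¹Y : delete the prefix X from Y (applied only when X is a prefix of Y)
delPre : Word → Word → Word
delPre X Y = drop (length X) Y

-- YZ⁻¹ : delete the suffix Z from Y (applied only when Z is a suffix of Y)
delSuf : Word → Word → Word
delSuf Y Z = take (length Y ∸ length Z) Y

Triple : Set
Triple = Word × Word × Word

small : ℕ → Word → Word → Word → Triple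
small n v u w₂ = v , u , (v ++ [ A n ] ++ w₂ ++ [ B n ] ++ w₂ ++ [ A n ] ++ w₂ ++ [ B n ] ++ u)

step : ℕ → Triple → Triple → Triple → Triple
step k t₂ t₄ t₆ = vn , un , wn
  where
    n₂ n₄ n₆ n : ℕ
    n  = 7 + k
    n₂ = 5 + k
    n₄ = 3 + k
    n₆ = 1 + k
    v₂ = proj₁ t₂
    u₂ = proj₁ (proj₂ t₂)
    w₂ = proj₂ (proj₂ t₂)
    v₄ = proj₁ t₄
    u₄ = proj₁ (proj₂ t₄)
    w₄ = proj₂ (proj₂ t₄)
    w₆ = proj₂ (proj₂ t₆)
    P : Word
    P = lcp w₆ (reverse v₄)
    c d : Letter
    c = firstLetter (delPre P (reverse v₄ ++ [ A n₂ ]))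
    d = firstLetter (delPre P (w₆ ++ [ B n₄ ]))
    vn un wn : Word
    vn = delPre (P ++ [ c ])
           (reverse v₄ ++ [ A n₂ ] ++ reverse v₂ ++ [ A n ] ++ v₂ ++ [ A n₂ ] ++ v₄ ++ [ A n₄ ]
             ++ w₆ ++ [ B n₄ ] ++ reverse w₆ ++ [ A n₄ ] ++ reverse v₄ ++ [ A n₂ ] ++ reverse v₂)
    un = delSuf
           (reverse u₂ ++ [ B n₂ ] ++ reverse w₄ ++ [ A n₂ ] ++ w₄ ++ [ B n₂ ] ++ reverse u₄
             ++ [ B n₄ ] ++ reverse w₆)
           (d ∷ reverse P)
    wn = vn ++ [ A n ] ++ w₂ ++ [ B n ] ++ reverse w₂ ++ [ A n ] ++ w₂ ++ [ B n ] ++ un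

-- vuw n = (v_n , u_n , w_n).  Index 0, and v,u at indices 1,2, are not defined
-- in the paper and never used; they are set to ε.
vuw : ℕ → Triple
vuw 0 = [] , [] , []
vuw 1 = [] , [] , [ A 1 ]
vuw 2 = [] , [] , (A 0 ∷ A 2 ∷ A 0 ∷ [])
vuw 3 = small 3 [] [] (proj₂ (proj₂ (vuw 1)))
vuw 4 = small 4 [ A 0 ] [ A 0 ] (proj₂ (proj₂ (vuw 2)))
vuw 5 = small 5 (A 5 ∷ A 3 ∷ A 1 ∷ A 3 ∷ []) (B 3 ∷ A 1 ∷ A 3 ∷ A 1 ∷ [])
                (proj₂ (proj₂ (vuw 3)))
vuw 6 = small 6 (A 0 ∷ A 6 ∷ A 0 ∷ A 4 ∷ A 0 ∷ A 2 ∷ A 0 ∷ A 4 ∷ A 0 ∷ [])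
                (A 0 ∷ B 4 ∷ A 0 ∷ A 2 ∷ A 0 ∷ A 4 ∷ A 0 ∷ A 2 ∷ A 0 ∷ [])
                (proj₂ (proj₂ (vuw 4)))
vuw (suc (suc (suc (suc (suc (suc (suc k))))))) =
  step k (vuw (suc (suc (suc (suc (suc k)))))) (vuw (suc (suc (suc k)))) (vuw (suc k))

v u w : ℕ → Word
v n = proj₁ (vuw n)
u n = proj₁ (proj₂ (vuw n))
w n = proj₂ (proj₂ (vuw n))

module Submission where

-- By construction v_n = (P_n c_n)⁻¹ V_n, where the "body" V_n is the word
--   ṽ₄ A ṽ₂ A v₂ A v₄ A w₆ B w̃₆ A ṽ₄ A ṽ₂   (indices relative to n),
-- made of three copies of v_{n-2}, three of v_{n-4}, two of w_{n-6} (up to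
-- reversal) and seven letters.  Hence |V_n| = 3|v₂| + 3|v₄| + 2|w₆| + 7.
-- The deleted prefix P_n c_n has length |P_n| + 1, and P_n, being a common
-- prefix of w_{n-6} and ṽ_{n-4}, has length at most |v_{n-4}|.  Deleting at
-- most |v₄| + 1 letters from V_n leaves the claimed bound.

open import Defs
open import Data.Nat using (ℕ; _+_; _*_; _∸_; _≤_; _≥_; z≤n; s≤s)
open import Data.Nat.Properties
  using (≤-trans; ≤-reflexive; +-assoc; +-monoˡ-≤; ∸-monoʳ-≤; m+n∸n≡m; module ≤-Reasoning)
open import Data.List using (List; []; _∷_; _++_; [_]; reverse; length; foldr; map)
open import Data.Nat.ListAction using (sum)
open import Data.List.Properties using (length-++; length-drop; length-reverse)
open import Data.Bool using (true; false)
open import Relation.Binary.PropositionalEquality using (_≡_; refl; sym; trans; cong)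
open import Data.Nat.Tactic.RingSolver using (solve)

length-foldr-++ : ∀ {A : Set} (xs : List (List A)) (z : List A) →
  length (foldr _++_ z xs) ≡ sum (map length xs) + length z
length-foldr-++ []       z = refl
length-foldr-++ (x ∷ xs) z = trans (length-++ x) (trans
  (cong (length x +_) (length-foldr-++ xs z))
  (sym (+-assoc (length x) (sum (map length xs)) (length z))))

length-delPre-≥ : ∀ (X Y : Word) {k : ℕ} → length X ≤ k → length Y ∸ k ≤ length (delPre X Y)
length-delPre-≥ X Y |X|≤k =
  ≤-trans (∸-monoʳ-≤ (length Y) |X|≤k) (≤-reflexive (sym (length-drop (length X) Y)))

length-lcp-≤ʳ : ∀ (xs ys : Word) → length (lcp xs ys) ≤ length ys
length-lcp-≤ʳ []       ys       = z≤n
length-lcp-≤ʳ (x ∷ xs) []       = z≤n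
length-lcp-≤ʳ (x ∷ xs) (y ∷ ys) with eqL x y
... | true  = s≤s (length-lcp-≤ʳ xs ys)
... | false = z≤n

vBody : (v₂ v₄ w₆ : Word) (a₁ a₂ a₃ a₄ a₅ a₆ a₇ : Letter) → Word
vBody v₂ v₄ w₆ a₁ a₂ a₃ a₄ a₅ a₆ a₇ =
  reverse v₄ ++ [ a₁ ] ++ reverse v₂ ++ [ a₂ ] ++ v₂ ++ [ a₃ ] ++ v₄ ++ [ a₄ ]
    ++ w₆ ++ [ a₅ ] ++ reverse w₆ ++ [ a₆ ] ++ reverse v₄ ++ [ a₇ ] ++ reverse v₂

-- |V_n| = 3|v₂| + 2|w₆| + 2|v₄| + 6 + (|v₄| + 1), split off the part
-- that the prefix deletion may consume.
length-vBody : ∀ (v₂ v₄ w₆ : Word) {a₁ a₂ a₃ a₄ a₅ a₆ a₇ : Letter} →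
  length (vBody v₂ v₄ w₆ a₁ a₂ a₃ a₄ a₅ a₆ a₇)
    ≡ (3 * length v₂ + 2 * length w₆ + 2 * length v₄ + 6) + (length v₄ + 1)
length-vBody v₂ v₄ w₆ {a₁} {a₂} {a₃} {a₄} {a₅} {a₆} {a₇} =
  trans (length-foldr-++ blocks (reverse v₂)) block-lengths
  where
  blocks : List Word
  blocks = reverse v₄ ∷ [ a₁ ] ∷ reverse v₂ ∷ [ a₂ ] ∷ v₂ ∷ [ a₃ ] ∷ v₄ ∷ [ a₄ ]
    ∷ w₆ ∷ [ a₅ ] ∷ reverse w₆ ∷ [ a₆ ] ∷ reverse v₄ ∷ [ a₇ ] ∷ []

  block-lengths : sum (map length blocks) + length (reverse v₂)
    ≡ (3 * length v₂ + 2 * length w₆ + 2 * length v₄ + 6) + (length v₄ + 1)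
  block-lengths rewrite length-reverse v₂ | length-reverse v₄ | length-reverse w₆ =
    count (length v₂) (length v₄) (length w₆)
    where
    count : ∀ x y z →
      y + (1 + (x + (1 + (x + (1 + (y + (1 + (z + (1 + (z + (1 + (y + (1 + 0))))))))))))) + x
        ≡ (3 * x + 2 * z + 2 * y + 6) + (y + 1)
    count x y z = solve (x ∷ y ∷ z ∷ [])

length-vBody-delPre : ∀ (v₂ v₄ w₆ P : Word) {c a₁ a₂ a₃ a₄ a₅ a₆ a₇ : Letter} →
  length P ≤ length v₄ →
  length (delPre (P ++ [ c ]) (vBody v₂ v₄ w₆ a₁ a₂ a₃ a₄ a₅ a₆ a₇))
    ≥ 3 * length v₂ + 2 * length w₆ + 2 * length v₄ + 6
length-vBody-delPre v₂ v₄ w₆ P {c} {a₁} {a₂} {a₃} {a₄} {a₅} {a₆} {a₇} |P|≤|v₄| = begin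
  bound                                     ≡⟨ sym (m+n∸n≡m bound (length v₄ + 1)) ⟩
  bound + (length v₄ + 1) ∸ (length v₄ + 1) ≡⟨ cong (_∸ (length v₄ + 1)) (sym (length-vBody v₂ v₄ w₆)) ⟩
  length body ∸ (length v₄ + 1)             ≤⟨ length-delPre-≥ (P ++ [ c ]) body |Pc|≤|v₄|+1 ⟩
  length (delPre (P ++ [ c ]) body)         ∎
  where
  open ≤-Reasoning
  bound : ℕ
  bound = 3 * length v₂ + 2 * length w₆ + 2 * length v₄ + 6
  body : Word
  body = vBody v₂ v₄ w₆ a₁ a₂ a₃ a₄ a₅ a₆ a₇
  |Pc|≤|v₄|+1 : length (P ++ [ c ]) ≤ length v₄ + 1
  |Pc|≤|v₄|+1 = ≤-trans (≤-reflexive (length-++ P)) (+-monoˡ-≤ 1 |P|≤|v₄|)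

-- For n = 7 + k, v_n is by definition (P_n c_n)⁻¹ V_n with
-- P_n = lcp(w_{n-6}, ṽ_{n-4}), so |P_n| ≤ |ṽ_{n-4}| = |v_{n-4}|.
lemma2p4 : (n : ℕ) → 7 ≤ n →
    length (v n) ≥ 3 * length (v (n ∸ 2)) + 2 * length (w (n ∸ 6)) + 2 * length (v (n ∸ 4)) + 6
lemma2p4 _ (s≤s (s≤s (s≤s (s≤s (s≤s (s≤s (s≤s {n = k} _))))))) =
  length-vBody-delPre (v (5 + k)) (v (3 + k)) (w (1 + k)) P |P|≤|v₄|
  where
  P : Word
  P = lcp (w (1 + k)) (reverse (v (3 + k)))
  |P|≤|v₄| : length P ≤ length (v (3 + k))
  |P|≤|v₄| = ≤-trans (length-lcp-≤ʳ (w (1 + k)) (reverse (v (3 + k))))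
                     (≤-reflexive (length-reverse (v (3 + k))))
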